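{- Let $a<b$ be positive integers with $\gcd(a,b-1)=1$. If every $(a,b)$-biregular graph has a cyclic interval $b$-coloring, then every $(a,b-1)$-biregular graph has a cyclic interval $b$-coloring.
   Context: All graphs are finite and undirected; multiple edges are allowed, loops are not. An $(a,b)$-biregular graph is a bipartite graph with a bipartition in which all vertices of one part have degree $a$ and all vertices of the other part have degree $b$. A proper $t$-edge coloring of $G$ is a map $\alpha:E(G)\to\{1,\dots,t\}$ with $\alpha(e)\neq\alpha(e')$ for adjacent edges $e,e'$; $S(v,\alpha)$ is the set of colors on edges incident to $v$. A proper $t$-edge coloring $\alpha$ is a cyclic interval $t$-coloring if for every vertex $v$, either $S(v,\alpha)$ or $\{1,\dots,t\}\setminus S(v,\alpha)$ is a set of consecutive integers. -}

module Defs where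

open import Data.Nat using (ℕ; _≤_; _<_; _+_)
open import Data.Fin using (Fin; toℕ)
import Data.Fin as F
open import Data.Bool using (Bool; true; false)
open import Data.Product using (Σ; ∃; _×_; _,_; proj₁; proj₂)
open import Data.Sum using (_⊎_)
open import Data.List using (List; length; filter)
open import Data.List using () renaming (allFin to allFinL)
open import Relation.Nullary using (¬_; Dec)
open import Relation.Nullary.Decidable using (_⊎-dec_)
open import Relation.Binary.PropositionalEquality using (_≡_; _≢_)

-- A finite undirected multigraph without loops:
-- vertices Fin n, edges Fin m, each edge has two (distinct) endpoints.
record Graph : Set where
  field
    n    : ℕ
    m    : ℕ
    ends : Fin m → Fin n × Fin n
    noLoop : ∀ e → proj₁ (ends e) ≢ proj₂ (ends e)

open Graph public

Incident : (G : Graph) → Fin (m G) → Fin (n G) → Set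
Incident G e v = (proj₁ (ends G e) ≡ v) ⊎ (proj₂ (ends G e) ≡ v)

incident? : (G : Graph) → (e : Fin (m G)) → (v : Fin (n G)) → Dec (Incident G e v)
incident? G e v = (proj₁ (ends G e) F.≟ v) ⊎-dec (proj₂ (ends G e) F.≟ v)

deg : (G : Graph) → Fin (n G) → ℕ
deg G v = length (filter (λ e → incident? G e v) (allFinL (m G)))

Biregular : Graph → ℕ → ℕ → Set
Biregular G a b =
  Σ (Fin (n G) → Bool) λ side →
    (∀ e → side (proj₁ (ends G e)) ≢ side (proj₂ (ends G e))) ×
    (∀ v → side v ≡ true → deg G v ≡ a) ×
    (∀ v → side v ≡ false → deg G v ≡ b)

-- proper t-edge coloring (colors 1..t are represented by Fin t, i.e. 0..t-1)
Proper : (G : Graph) (t : ℕ) → (Fin (m G) → Fin t) → Set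
Proper G t α = ∀ e e' → e ≢ e' → (∃ λ v → Incident G e v × Incident G e' v) → α e ≢ α e'

S : (G : Graph) (t : ℕ) → (Fin (m G) → Fin t) → Fin (n G) → Fin t → Set
S G t α v c = ∃ λ e → Incident G e v × α e ≡ c

Consecutive : (t : ℕ) → (Fin t → Set) → Set
Consecutive t X = ∃ λ lo → ∃ λ len → ∀ c →
  (X c → lo ≤ toℕ c × toℕ c < lo + len) × (lo ≤ toℕ c × toℕ c < lo + len → X c)

CyclicInterval : (G : Graph) (t : ℕ) → (Fin (m G) → Fin t) → Set
CyclicInterval G t α = Proper G t α ×
  (∀ v → Consecutive t (S G t α v) ⊎ Consecutive t (λ c → ¬ S G t α v c))

HasCyclicInterval : Graph → ℕ → Set
HasCyclicInterval G t = Σ (Fin (m G) → Fin t) λ α → CyclicInterval G t α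

-- Take a copies of G and, for every vertex y of degree b - 1, a new vertex adjacent to the a copies
-- of y. The result is (a, b)-biregular, so it has a cyclic interval b-coloring; restrict it to one
-- copy of G. Vertices of degree a keep their color sets. A vertex of degree b - 1 had degree b in
-- the big graph, hence saw all b colors there; in G it misses exactly the color of its new edge,
-- and a single missing color is a cyclic interval.

module Submission where

open import Defs
open import Data.Nat using (ℕ; _<_; _∸_)
open import Data.Nat.GCD using (gcd)
open import Relation.Binary.PropositionalEquality using (_≡_)

open import Data.Bool using (Bool; true; false)
import Data.Bool as B
open import Data.Empty using (⊥; ⊥-elim)
open import Data.Fin using (Fin; zero; suc; toℕ; _↑ˡ_; _↑ʳ_; combine; remQuot; splitAt; punchOut)
import Data.Fin as F
open import Data.Fin.Properties
  using (remQuot-combine; combine-remQuot; splitAt-↑ˡ; splitAt-↑ʳ; splitAt⁻¹-↑ˡ; splitAt⁻¹-↑ʳ; ↑ˡ-injective; ↑ʳ-injective;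
         combine-injective; suc-injective; 0≢1+n; pigeonhole; punchOut-injective; <⇒≢; toℕ-injective)
open import Data.List using (allFin; List; _∷_; _++_; length; filter; tabulate; lookup)
open import Data.List.Properties using (length-++; filter-++)
open import Data.List.Membership.Propositional using (_∈_; find; lose)
open import Data.List.Membership.Propositional.Properties using (∈-filter⁻; ∈-filter⁺; ∈-allFin; ∈-lookup)
import Data.List.Relation.Unary.All as All
open import Data.List.Relation.Unary.AllPairs using (_∷_)
open import Data.List.Relation.Unary.Any using (any?; index)
open import Data.List.Relation.Unary.Any.Properties using (lookup-index)
open import Data.List.Relation.Unary.Unique.Propositional using (Unique)
import Data.List.Relation.Unary.Unique.Propositional.Properties as UniqueP
open import Data.Nat using (zero; suc; _+_; _*_; _≤_)
open import Data.Nat.Properties using (+-0-monoid; +-identityʳ; +-comm; ≤-refl; ≤-antisym; m<1+n⇒m≤n)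
open import Algebra.Properties.Monoid.Sum +-0-monoid using (sum; sum-cong-≗; sum-replicate-zero; sum-syntax)
open import Data.Product using (∃; ∃₂; _×_; _,_; proj₁; proj₂; uncurry)
import Data.Product as Product
open import Data.Sum using (_⊎_; inj₁; inj₂; [_,_]′)
import Data.Sum as Sum
open import Function using (id; _∘_; _⇔_; mk⇔; Equivalence)
open import Function.Related.TypeIsomorphisms using (¬-cong-⇔)
open import Relation.Nullary using (¬_; yes; no)
open import Relation.Unary using (Decidable)
open import Relation.Binary.PropositionalEquality using (_≢_; refl; sym; trans; cong; cong₂; subst; module ≡-Reasoning)

module _ {A : Set} {P : A → Set} (P? : Decidable P) where

  count : List A → ℕ
  count = length ∘ filter P?

  count-++ : ∀ xs ys → count (xs ++ ys) ≡ count xs + count ys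
  count-++ xs ys = trans (cong length (filter-++ P? xs ys)) (length-++ (filter P? xs))

  count-tabulate-none : ∀ {k} (f : Fin k → A) → (∀ i → ¬ P (f i)) → count (tabulate f) ≡ 0
  count-tabulate-none {zero}  f ¬p = refl
  count-tabulate-none {suc k} f ¬p with P? (f zero)
  ... | yes p = ⊥-elim (¬p zero p)
  ... | no _  = count-tabulate-none (f ∘ suc) (¬p ∘ suc)

  count-tabulate-unique : ∀ {k} (f : Fin k → A) (i₀ : Fin k) →
    P (f i₀) → (∀ i → P (f i) → i ≡ i₀) → count (tabulate f) ≡ 1
  count-tabulate-unique f zero p₀ uniq with P? (f zero)
  ... | yes _ = cong suc (count-tabulate-none (f ∘ suc) (λ i → 0≢1+n ∘ sym ∘ uniq (suc i)))
  ... | no ¬p = ⊥-elim (¬p p₀)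
  count-tabulate-unique f (suc i₀) p₀ uniq with P? (f zero)
  ... | yes p = ⊥-elim (0≢1+n (uniq zero p))
  ... | no _  = count-tabulate-unique (f ∘ suc) i₀ p₀ (λ i → suc-injective ∘ uniq (suc i))

  count-tabulate-+ : ∀ p {q} (f : Fin (p + q) → A) →
    count (tabulate f) ≡ count (tabulate (f ∘ (_↑ˡ q))) + count (tabulate (f ∘ (p ↑ʳ_)))
  count-tabulate-+ p {q} f = trans (cong count (tabulate-+ p f)) (count-++ (tabulate (f ∘ (_↑ˡ q))) _)
    where
    tabulate-+ : ∀ p (f : Fin (p + q) → A) → tabulate f ≡ tabulate (f ∘ (_↑ˡ q)) ++ tabulate (f ∘ (p ↑ʳ_))
    tabulate-+ zero    f = refl
    tabulate-+ (suc p) f = cong (f zero ∷_) (tabulate-+ p (f ∘ suc))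

  count-tabulate-combine : ∀ a {x} (f : Fin (a * x) → A) →
    count (tabulate f) ≡ ∑[ c < a ] count (tabulate (f ∘ combine c))
  count-tabulate-combine zero    f = refl
  count-tabulate-combine (suc a) {x} f =
    trans (count-tabulate-+ x f) (cong (count (tabulate (f ∘ (_↑ˡ (a * x)))) +_) (count-tabulate-combine a (f ∘ (x ↑ʳ_))))

count-tabulate-⇔ : {A B : Set} {P : A → Set} {Q : B → Set} (P? : Decidable P) (Q? : Decidable Q) →
  ∀ {k} (f : Fin k → A) (g : Fin k → B) → (∀ i → P (f i) ⇔ Q (g i)) →
  count P? (tabulate f) ≡ count Q? (tabulate g)
count-tabulate-⇔ P? Q? {zero}  f g eq = refl
count-tabulate-⇔ P? Q? {suc k} f g eq with P? (f zero) | Q? (g zero)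
... | yes _ | yes _ = cong suc (count-tabulate-⇔ P? Q? (f ∘ suc) (g ∘ suc) (eq ∘ suc))
... | yes p | no ¬q = ⊥-elim (¬q (Equivalence.to (eq zero) p))
... | no ¬p | yes q = ⊥-elim (¬p (Equivalence.from (eq zero) q))
... | no _  | no _  = count-tabulate-⇔ P? Q? (f ∘ suc) (g ∘ suc) (eq ∘ suc)

sum-ones : ∀ a (g : Fin a → ℕ) → (∀ c → g c ≡ 1) → sum g ≡ a
sum-ones zero    g ones = refl
sum-ones (suc a) g ones = cong₂ _+_ (ones zero) (sum-ones a (g ∘ suc) (ones ∘ suc))

sum-zero-except : ∀ a (g : Fin a → ℕ) (c₀ : Fin a) → (∀ c → c ≢ c₀ → g c ≡ 0) → sum g ≡ g c₀
sum-zero-except (suc a) g zero others =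
  trans (cong (g zero +_) (trans (sum-cong-≗ (λ c → others (suc c) λ ())) (sum-replicate-zero a))) (+-identityʳ _)
sum-zero-except (suc a) g (suc c₀) others =
  trans (cong (_+ sum (g ∘ suc)) (others zero λ ()))
        (sum-zero-except a (g ∘ suc) c₀ (λ c c≢c₀ → others (suc c) (c≢c₀ ∘ suc-injective)))

Unique⇒lookup-injective : {A : Set} (xs : List A) → Unique xs → ∀ i j → lookup xs i ≡ lookup xs j → i ≡ j
Unique⇒lookup-injective (x ∷ xs) (x∉ ∷ u) zero    zero    eq = refl
Unique⇒lookup-injective (x ∷ xs) (x∉ ∷ u) zero    (suc j) eq = ⊥-elim (All.lookup x∉ (∈-lookup j) eq)
Unique⇒lookup-injective (x ∷ xs) (x∉ ∷ u) (suc i) zero    eq = ⊥-elim (All.lookup x∉ (∈-lookup i) (sym eq))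
Unique⇒lookup-injective (x ∷ xs) (x∉ ∷ u) (suc i) (suc j) eq = cong suc (Unique⇒lookup-injective xs u i j eq)

Consecutive-resp-⇔ : ∀ {t} {X Y : Fin t → Set} → (∀ c → X c ⇔ Y c) → Consecutive t X → Consecutive t Y
Consecutive-resp-⇔ X⇔Y (lo , len , inside) =
  lo , len , λ c → proj₁ (inside c) ∘ Equivalence.from (X⇔Y c) , Equivalence.to (X⇔Y c) ∘ proj₂ (inside c)

Consecutive-singleton : ∀ {t} {X : Fin t → Set} (c₀ : Fin t) → (∀ c → X c ⇔ c ≡ c₀) → Consecutive t X
Consecutive-singleton {X = X} c₀ X⇔≡c₀ =
  toℕ c₀ , 1 , λ c → bounds c ∘ Equivalence.to (X⇔≡c₀ c) , Equivalence.from (X⇔≡c₀ c) ∘ bounded c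
  where
  bounds : ∀ c → c ≡ c₀ → toℕ c₀ ≤ toℕ c × toℕ c < toℕ c₀ + 1
  bounds c refl = ≤-refl , subst (toℕ c₀ <_) (+-comm 1 (toℕ c₀)) ≤-refl
  bounded : ∀ c → toℕ c₀ ≤ toℕ c × toℕ c < toℕ c₀ + 1 → c ≡ c₀
  bounded c (c₀≤c , c<c₀+1) =
    toℕ-injective (≤-antisym (m<1+n⇒m≤n (subst (toℕ c <_) (+-comm (toℕ c₀) 1) c<c₀+1)) c₀≤c)

module _ (K : Graph) (w : Fin (n K)) where

  incidentEdges : List (Fin (m K))
  incidentEdges = filter (λ e → incident? K e w) (allFin (m K))

  incidentEdges-unique : Unique incidentEdges
  incidentEdges-unique = UniqueP.filter⁺ (λ e → incident? K e w) (UniqueP.allFin⁺ (m K))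

  ∈-incidentEdges⁻ : ∀ {e} → e ∈ incidentEdges → Incident K e w
  ∈-incidentEdges⁻ e∈ = proj₂ (∈-filter⁻ (λ e → incident? K e w) {xs = allFin (m K)} e∈)

-- If a color c were missing at w, the deg w = t incident edges would get only t - 1 colors.
proper⇒S-full : (K : Graph) {t : ℕ} (β : Fin (m K) → Fin t) → Proper K t β →
  ∀ w → deg K w ≡ t → ∀ c → S K t β w c
proper⇒S-full K {suc t} β proper w deg≡ c with any? (λ e → β e F.≟ c) (incidentEdges K w)
... | yes seen with e , e∈ , βe≡c ← find seen = e , ∈-incidentEdges⁻ K w e∈ , βe≡c
... | no unseen = ⊥-elim (collision (pigeonhole t<deg (λ i → punchOut (missing i))))
  where
  edge = lookup (incidentEdges K w)
  missing : ∀ i → c ≢ β (edge i)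
  missing i c≡ = unseen (lose (∈-lookup i) (sym c≡))
  t<deg : t < length (incidentEdges K w)
  t<deg = subst (t <_) (sym deg≡) ≤-refl
  collision : (∃₂ λ i j → i F.< j × punchOut (missing i) ≡ punchOut (missing j)) → ⊥
  collision (i , j , i<j , same) =
    proper (edge i) (edge j) (<⇒≢ i<j ∘ Unique⇒lookup-injective _ (incidentEdges-unique K w) i j)
           (w , ∈-incidentEdges⁻ K w (∈-lookup i) , ∈-incidentEdges⁻ K w (∈-lookup j))
           (punchOut-injective (missing i) (missing j) same)

-- H has vertices copy c v (c < a, v in G) followed by one apex per deficient vertex y j, i.e. per
-- vertex on the false side of G; its edges are the copies of the edges of G and, for each c and j,
-- a spoke from copy c (y j) to apex j.
module Extension (a : ℕ) (G : Graph) (side : Fin (n G) → Bool) where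

  deficient : List (Fin (n G))
  deficient = filter (λ v → side v B.≟ false) (allFin (n G))

  k : ℕ
  k = length deficient

  y : Fin k → Fin (n G)
  y = lookup deficient

  y-side : ∀ j → side (y j) ≡ false
  y-side j = proj₂ (∈-filter⁻ (λ v → side v B.≟ false) {xs = allFin (n G)} (∈-lookup j))

  y-injective : ∀ i j → y i ≡ y j → i ≡ j
  y-injective = Unique⇒lookup-injective deficient
    (UniqueP.filter⁺ (λ v → side v B.≟ false) (UniqueP.allFin⁺ (n G)))

  y⁻¹ : ∀ {v} → side v ≡ false → Fin k
  y⁻¹ {v} s = index (∈-filter⁺ (λ v → side v B.≟ false) (∈-allFin v) s)

  y-y⁻¹ : ∀ {v} (s : side v ≡ false) → y (y⁻¹ s) ≡ v
  y-y⁻¹ {v} s = sym (lookup-index (∈-filter⁺ (λ v → side v B.≟ false) (∈-allFin v) s))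

  y≢nondeficient : ∀ {v j} → side v ≡ true → y j ≢ v
  y≢nondeficient {j = j} s refl with () ← trans (sym (y-side j)) s

  copy : Fin a → Fin (n G) → Fin (a * n G + k)
  copy c v = combine c v ↑ˡ k

  apex : Fin k → Fin (a * n G + k)
  apex j = (a * n G) ↑ʳ j

  copyEdge : Fin a → Fin (m G) → Fin (a * (m G + k))
  copyEdge c e = combine c (e ↑ˡ k)

  spoke : Fin a → Fin k → Fin (a * (m G + k))
  spoke c j = combine c (m G ↑ʳ j)

  endsInCopy : Fin a → Fin (m G + k) → Fin (a * n G + k) × Fin (a * n G + k)
  endsInCopy c = [ (λ e → copy c (proj₁ (ends G e)) , copy c (proj₂ (ends G e))) , (λ j → copy c (y j) , apex j) ]′
           ∘ splitAt (m G)

  endsH : Fin (a * (m G + k)) → Fin (a * n G + k) × Fin (a * n G + k)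
  endsH = uncurry endsInCopy ∘ remQuot (m G + k)

  endsH-copyEdge : ∀ c e → endsH (copyEdge c e) ≡ (copy c (proj₁ (ends G e)) , copy c (proj₂ (ends G e)))
  endsH-copyEdge c e = trans (cong (uncurry endsInCopy) (remQuot-combine c (e ↑ˡ k)))
                             (cong [ _ , _ ]′ (splitAt-↑ˡ (m G) e k))

  endsH-spoke : ∀ c j → endsH (spoke c j) ≡ (copy c (y j) , apex j)
  endsH-spoke c j = trans (cong (uncurry endsInCopy) (remQuot-combine c (m G ↑ʳ j)))
                          (cong [ _ , _ ]′ (splitAt-↑ʳ (m G) k j))

  data EdgeView : Fin (a * (m G + k)) → Set where
    is-copyEdge : ∀ c e → EdgeView (copyEdge c e)
    is-spoke    : ∀ c j → EdgeView (spoke c j)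

  edgeView : ∀ x → EdgeView x
  edgeView x = subst EdgeView (combine-remQuot {a} (m G + k) x) (blockView (remQuot {a} (m G + k) x))
    where
    blockView : ∀ p → EdgeView (uncurry combine p)
    blockView (c , e′) with splitAt (m G) e′ in eq
    ... | inj₁ e with refl ← splitAt⁻¹-↑ˡ eq = is-copyEdge c e
    ... | inj₂ j with refl ← splitAt⁻¹-↑ʳ eq = is-spoke c j

  data VertexView : Fin (a * n G + k) → Set where
    is-copy : ∀ c v → VertexView (copy c v)
    is-apex : ∀ j → VertexView (apex j)

  vertexView : ∀ w → VertexView w
  vertexView w with splitAt (a * n G) {k} w in eq
  ... | inj₂ j with refl ← splitAt⁻¹-↑ʳ eq = is-apex j
  ... | inj₁ u with refl ← splitAt⁻¹-↑ˡ eq =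
    subst (VertexView ∘ (_↑ˡ k)) (combine-remQuot {a} (n G) u) (blockView (remQuot {a} (n G) u))
    where
    blockView : ∀ p → VertexView (uncurry combine p ↑ˡ k)
    blockView (c , v) = is-copy c v

  copy-injective : ∀ {c c′ v v′} → copy c v ≡ copy c′ v′ → c ≡ c′ × v ≡ v′
  copy-injective eq = combine-injective _ _ _ _ (↑ˡ-injective k _ _ eq)

  copy≢apex : ∀ {c v j} → copy c v ≢ apex j
  copy≢apex {c} {v} {j} eq with () ← trans (sym (splitAt-↑ˡ (a * n G) (combine c v) k))
                                      (trans (cong (splitAt (a * n G)) eq) (splitAt-↑ʳ (a * n G) k j))

  copyEdge-injective : ∀ {c c′ e e′} → copyEdge c e ≡ copyEdge c′ e′ → c ≡ c′ × e ≡ e′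
  copyEdge-injective eq with c≡c′ , e≡e′ ← combine-injective _ _ _ _ eq = c≡c′ , ↑ˡ-injective k _ _ e≡e′

  copyEdge≢spoke : ∀ {c c′ e j} → copyEdge c e ≢ spoke c′ j
  copyEdge≢spoke {c} {c′} {e} {j} eq with () ← trans (sym (splitAt-↑ˡ (m G) e k))
      (trans (cong (splitAt (m G)) (proj₂ (combine-injective c _ c′ _ eq))) (splitAt-↑ʳ (m G) k j))

  noLoopH : ∀ x → proj₁ (endsH x) ≢ proj₂ (endsH x)
  noLoopH x with edgeView x
  ... | is-copyEdge c e rewrite endsH-copyEdge c e = noLoop G e ∘ proj₂ ∘ copy-injective
  ... | is-spoke c j rewrite endsH-spoke c j = copy≢apex

  H : Graph
  H = record { n = a * n G + k ; m = a * (m G + k) ; ends = endsH ; noLoop = noLoopH }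

  sideH : Fin (a * n G + k) → Bool
  sideH = [ side ∘ proj₂ ∘ remQuot {a} (n G) , (λ _ → true) ]′ ∘ splitAt (a * n G)

  sideH-copy : ∀ c v → sideH (copy c v) ≡ side v
  sideH-copy c v = trans (cong [ _ , _ ]′ (splitAt-↑ˡ (a * n G) (combine c v) k))
                         (cong (side ∘ proj₂) (remQuot-combine c v))

  sideH-apex : ∀ j → sideH (apex j) ≡ true
  sideH-apex j = cong [ _ , _ ]′ (splitAt-↑ʳ (a * n G) k j)

  copyEdge-incident : ∀ c {e v} → Incident G e v → Incident H (copyEdge c e) (copy c v)
  copyEdge-incident c {e} i rewrite endsH-copyEdge c e = Sum.map (cong (copy c)) (cong (copy c)) i

  copyEdge-incident⁻ : ∀ {c e c′ v} → Incident H (copyEdge c e) (copy c′ v) → c ≡ c′ × Incident G e v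
  copyEdge-incident⁻ {c} {e} i rewrite endsH-copyEdge c e with i
  ... | inj₁ eq = Product.map₂ inj₁ (copy-injective eq)
  ... | inj₂ eq = Product.map₂ inj₂ (copy-injective eq)

  copyEdge-¬incident-apex : ∀ {c e j} → ¬ Incident H (copyEdge c e) (apex j)
  copyEdge-¬incident-apex {c} {e} i rewrite endsH-copyEdge c e with i
  ... | inj₁ eq = copy≢apex eq
  ... | inj₂ eq = copy≢apex eq

  spoke-incident : ∀ c j → Incident H (spoke c j) (copy c (y j))
  spoke-incident c j rewrite endsH-spoke c j = inj₁ refl

  spoke-incident⁻ : ∀ {c j c′ v} → Incident H (spoke c j) (copy c′ v) → c ≡ c′ × y j ≡ v
  spoke-incident⁻ {c} {j} i rewrite endsH-spoke c j with i
  ... | inj₁ eq = copy-injective eq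
  ... | inj₂ eq = ⊥-elim (copy≢apex (sym eq))

  spoke-incident-apex : ∀ c j → Incident H (spoke c j) (apex j)
  spoke-incident-apex c j rewrite endsH-spoke c j = inj₂ refl

  spoke-incident-apex⁻ : ∀ {c j j′} → Incident H (spoke c j) (apex j′) → j ≡ j′
  spoke-incident-apex⁻ {c} {j} i rewrite endsH-spoke c j with i
  ... | inj₁ eq = ⊥-elim (copy≢apex eq)
  ... | inj₂ eq = ↑ʳ-injective (a * n G) _ _ eq

  H-bipartite : (∀ e → side (proj₁ (ends G e)) ≢ side (proj₂ (ends G e))) →
    ∀ x → sideH (proj₁ (ends H x)) ≢ sideH (proj₂ (ends H x))
  H-bipartite bip x with edgeView x
  ... | is-copyEdge c e rewrite endsH-copyEdge c e | sideH-copy c (proj₁ (ends G e)) | sideH-copy c (proj₂ (ends G e)) = bip e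
  ... | is-spoke c j rewrite endsH-spoke c j | sideH-copy c (y j) | sideH-apex j | y-side j = λ ()

  deg-H : ∀ w → deg H w ≡ ∑[ c < a ] (count (λ x → incident? H x w) (tabulate (copyEdge c))
                                     + count (λ x → incident? H x w) (tabulate (spoke c)))
  deg-H w = trans (count-tabulate-combine P? a id) (sum-cong-≗ (λ c → count-tabulate-+ P? (m G) {k} (combine {a} c)))
    where P? = λ x → incident? H x w

  deg-H-copy : ∀ c₀ v → deg H (copy c₀ v) ≡ deg G v + count (λ j → y j F.≟ v) (allFin k)
  deg-H-copy c₀ v = begin
    deg H (copy c₀ v)             ≡⟨ deg-H (copy c₀ v) ⟩
    ∑[ c < a ] block c            ≡⟨ sum-zero-except a block c₀ other-copy ⟩
    block c₀                      ≡⟨ cong₂ _+_ (count-tabulate-⇔ P? (λ e → incident? G e v) (copyEdge c₀) id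
                                                  (λ e → mk⇔ (proj₂ ∘ copyEdge-incident⁻) (copyEdge-incident c₀)))
                                               (count-tabulate-⇔ P? (λ j → y j F.≟ v) (spoke c₀) id
                                                  (λ j → mk⇔ (proj₂ ∘ spoke-incident⁻) λ { refl → spoke-incident c₀ j })) ⟩
    deg G v + count (λ j → y j F.≟ v) (allFin k) ∎
    where
    open ≡-Reasoning
    P? = λ x → incident? H x (copy c₀ v)
    block : Fin a → ℕ
    block c = count P? (tabulate (copyEdge c)) + count P? (tabulate (spoke c))
    other-copy : ∀ c → c ≢ c₀ → block c ≡ 0
    other-copy c c≢c₀ = cong₂ _+_ (count-tabulate-none P? (copyEdge c) (λ e → c≢c₀ ∘ proj₁ ∘ copyEdge-incident⁻))
                                  (count-tabulate-none P? (spoke c) (λ j → c≢c₀ ∘ proj₁ ∘ spoke-incident⁻))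

  deg-H-copy-true : ∀ c {v} → side v ≡ true → deg H (copy c v) ≡ deg G v
  deg-H-copy-true c {v} s = trans (deg-H-copy c v) (trans (cong (deg G v +_) no-apex) (+-identityʳ (deg G v)))
    where
    no-apex : count (λ j → y j F.≟ v) (allFin k) ≡ 0
    no-apex = count-tabulate-none (λ j → y j F.≟ v) id (λ j → y≢nondeficient s)

  deg-H-copy-false : ∀ c {v} → side v ≡ false → deg H (copy c v) ≡ suc (deg G v)
  deg-H-copy-false c {v} s = trans (deg-H-copy c v) (trans (cong (deg G v +_) one-apex) (+-comm (deg G v) 1))
    where
    one-apex : count (λ j → y j F.≟ v) (allFin k) ≡ 1
    one-apex = count-tabulate-unique (λ j → y j F.≟ v) id (y⁻¹ s) (y-y⁻¹ s) (λ j yj≡v → y-injective j (y⁻¹ s) (trans yj≡v (sym (y-y⁻¹ s))))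

  deg-H-apex : ∀ j₀ → deg H (apex j₀) ≡ a
  deg-H-apex j₀ = trans (deg-H (apex j₀)) (sum-ones a _ λ c →
    cong₂ _+_ (count-tabulate-none P? (copyEdge c) (λ e → copyEdge-¬incident-apex))
              (count-tabulate-unique P? (spoke c) j₀ (spoke-incident-apex c j₀) (λ j → spoke-incident-apex⁻)))
    where P? = λ x → incident? H x (apex j₀)

  H-biregular : ∀ {b} → (∀ e → side (proj₁ (ends G e)) ≢ side (proj₂ (ends G e))) →
    (∀ v → side v ≡ true → deg G v ≡ a) → (∀ v → side v ≡ false → deg G v ≡ b) →
    Biregular H a (suc b)
  H-biregular bip deg-true deg-false = sideH , H-bipartite bip , degH-true , degH-false
    where
    degH-true : ∀ w → sideH w ≡ true → deg H w ≡ a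
    degH-true w s with vertexView w
    ... | is-copy c v = let s′ = trans (sym (sideH-copy c v)) s in trans (deg-H-copy-true c s′) (deg-true v s′)
    ... | is-apex j = deg-H-apex j
    degH-false : ∀ w → sideH w ≡ false → deg H w ≡ suc _
    degH-false w s with vertexView w
    ... | is-copy c v = let s′ = trans (sym (sideH-copy c v)) s in trans (deg-H-copy-false c s′) (cong suc (deg-false v s′))
    ... | is-apex j with () ← trans (sym s) (sideH-apex j)

  module _ {t} (β : Fin (m H) → Fin t) (c₀ : Fin a) where

    S-copy : ∀ {v col} → S G t (β ∘ copyEdge c₀) v col → S H t β (copy c₀ v) col
    S-copy (e , i , eq) = copyEdge c₀ e , copyEdge-incident c₀ i , eq

    S-copy⁻ : ∀ {v col} → S H t β (copy c₀ v) col →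
      S G t (β ∘ copyEdge c₀) v col ⊎ ∃ λ j → y j ≡ v × β (spoke c₀ j) ≡ col
    S-copy⁻ (x , i , eq) with edgeView x
    ... | is-copyEdge c e with refl , iG ← copyEdge-incident⁻ i = inj₁ (e , iG , eq)
    ... | is-spoke c j with refl , yj≡v ← spoke-incident⁻ i = inj₂ (j , yj≡v , eq)

    S-copy-nondeficient : ∀ {v col} → side v ≡ true → S H t β (copy c₀ v) col ⇔ S G t (β ∘ copyEdge c₀) v col
    S-copy-nondeficient s = mk⇔ ([ id , (λ (j , yj≡v , _) → ⊥-elim (y≢nondeficient s yj≡v)) ]′ ∘ S-copy⁻) S-copy

    -- In H a deficient vertex sees every color, and its spoke is its only edge missing from G.
    ∁S-copy-deficient : Proper H t β → ∀ {v col} → (s : side v ≡ false) → deg H (copy c₀ v) ≡ t →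
      (¬ S G t (β ∘ copyEdge c₀) v col) ⇔ col ≡ β (spoke c₀ (y⁻¹ s))
    ∁S-copy-deficient proper {v} {col} s full = mk⇔ only-spoke not-in-G
      where
      only-spoke : ¬ S G t (β ∘ copyEdge c₀) v col → col ≡ β (spoke c₀ (y⁻¹ s))
      only-spoke ¬SG with S-copy⁻ (proper⇒S-full H β proper (copy c₀ v) full col)
      ... | inj₁ SG = ⊥-elim (¬SG SG)
      ... | inj₂ (j , yj≡v , eq) rewrite y-injective j (y⁻¹ s) (trans yj≡v (sym (y-y⁻¹ s))) = sym eq
      not-in-G : col ≡ β (spoke c₀ (y⁻¹ s)) → ¬ S G t (β ∘ copyEdge c₀) v col
      not-in-G col≡ (e , i , eq) =
        proper (copyEdge c₀ e) (spoke c₀ (y⁻¹ s)) copyEdge≢spoke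
               (copy c₀ v , copyEdge-incident c₀ i , subst (Incident H (spoke c₀ (y⁻¹ s)) ∘ copy c₀) (y-y⁻¹ s) (spoke-incident c₀ (y⁻¹ s)))
               (trans eq col≡)

  restrict : ∀ {b} → Fin a → (∀ v → side v ≡ false → deg G v ≡ b) →
    HasCyclicInterval H (suc b) → HasCyclicInterval G (suc b)
  restrict c₀ deg-false (β , proper , cyclic) = β ∘ copyEdge c₀ , properG , cyclicG
    where
    properG : Proper G _ (β ∘ copyEdge c₀)
    properG e e′ e≢e′ (v , i , i′) =
      proper _ _ (e≢e′ ∘ proj₂ ∘ copyEdge-injective) (copy c₀ v , copyEdge-incident c₀ i , copyEdge-incident c₀ i′)
    cyclicG : ∀ v → Consecutive _ (S G _ (β ∘ copyEdge c₀) v) ⊎ Consecutive _ (λ col → ¬ S G _ (β ∘ copyEdge c₀) v col)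
    cyclicG v with side v in s
    ... | true = Sum.map (Consecutive-resp-⇔ (λ _ → S-copy-nondeficient β c₀ s))
                         (Consecutive-resp-⇔ (λ _ → ¬-cong-⇔ (S-copy-nondeficient β c₀ s)))
                         (cyclic (copy c₀ v))
    ... | false = inj₂ (Consecutive-singleton _ (λ _ →
                    ∁S-copy-deficient β c₀ proper s (trans (deg-H-copy-false c₀ s) (cong suc (deg-false v s)))))

theorem4 : (a b : ℕ) → 0 < a → a < b → gcd a (b ∸ 1) ≡ 1 →
    (∀ (G : Graph) → Biregular G a b → HasCyclicInterval G b) →
    ∀ (G : Graph) → Biregular G a (b ∸ 1) → HasCyclicInterval G b
theorem4 zero    _       ()  _   _ _      _ _
theorem4 (suc a) zero    _   ()  _ _      _ _
theorem4 (suc a) (suc b) _   _   _ extend G (side , bipartite , deg-true , deg-false) =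
  restrict zero deg-false (extend H (H-biregular bipartite deg-true deg-false))
  where open Extension (suc a) G side
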